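{- Let $\mathcal{C}=\{C_1,\dots,C_k\}$ be a set of vertex-disjoint cycles and let $f$ be an edge (all in a complete graph). Then $\{f\}\oplus E(\mathcal{C})$ can be odd-covered using two paths.
   Context: Graphs are simple; cycles have at least three vertices. $E(\mathcal C)=\bigcup_i E(C_i)$; $\oplus$ denotes symmetric difference. A set $F$ of edges of a complete graph is odd-covered by paths $P_1,\dots,P_m$ of that complete graph if $E(P_1)\oplus\cdots\oplus E(P_m)=F$. -}

module Defs where

open import Data.Nat using (ℕ; _≤_)
open import Data.Bool using (Bool; true; false; _∧_; _∨_; _xor_)
open import Data.Fin using (Fin; _≟_)
open import Data.List using (List; []; _∷_; length; concat)
open import Data.List.Relation.Unary.All using (All)
open import Data.List.Relation.Unary.Unique.Propositional using (Unique)
open import Data.Product using (_×_)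
open import Relation.Nullary.Decidable using (⌊_⌋)

-- Vertices of the complete graph K_n are Fin n. Every pair of distinct
-- vertices is an edge of K_n.  An edge set is given by its (symmetric)
-- characteristic function.
EdgeSet : ℕ → Set
EdgeSet n = Fin n → Fin n → Bool

edgeInd : ∀ {n} → Fin n → Fin n → EdgeSet n
edgeInd a b u v = (⌊ a ≟ u ⌋ ∧ ⌊ b ≟ v ⌋) ∨ (⌊ a ≟ v ⌋ ∧ ⌊ b ≟ u ⌋)

∅ₑ : ∀ {n} → EdgeSet n
∅ₑ u v = false

_∪ₑ_ : ∀ {n} → EdgeSet n → EdgeSet n → EdgeSet n
(A ∪ₑ B) u v = A u v ∨ B u v

_⊕ₑ_ : ∀ {n} → EdgeSet n → EdgeSet n → EdgeSet n
(A ⊕ₑ B) u v = A u v xor B u v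

-- A path of K_n: a nonempty sequence of distinct vertices
-- (a single vertex is the trivial path with no edges).
IsPath : ∀ {n} → List (Fin n) → Set
IsPath vs = (1 ≤ length vs) × Unique vs

walkEdges : ∀ {n} → List (Fin n) → EdgeSet n
walkEdges []           = ∅ₑ
walkEdges (a ∷ [])     = ∅ₑ
walkEdges (a ∷ b ∷ vs) = edgeInd a b ∪ₑ walkEdges (b ∷ vs)

last' : ∀ {n} → Fin n → List (Fin n) → Fin n
last' a []       = a
last' a (b ∷ vs) = last' b vs

-- A cycle of K_n: a sequence v1 … vk of k ≥ 3 distinct vertices;
-- its edges are v1v2, …, v(k-1)vk, vkv1.
IsCycle : ∀ {n} → List (Fin n) → Set
IsCycle vs = (3 ≤ length vs) × Unique vs

cycleEdges : ∀ {n} → List (Fin n) → EdgeSet n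
cycleEdges []       = ∅ₑ
cycleEdges (a ∷ vs) = walkEdges (a ∷ vs) ∪ₑ edgeInd (last' a vs) a

cyclesEdges : ∀ {n} → List (List (Fin n)) → EdgeSet n
cyclesEdges []       = ∅ₑ
cyclesEdges (c ∷ cs) = cycleEdges c ∪ₑ cyclesEdges cs

VertexDisjointCycles : ∀ {n} → List (List (Fin n)) → Set
VertexDisjointCycles cs = All IsCycle cs × Unique (concat cs)

-- Everything is computed in the GF(2) edge space, where the union of edge-disjoint sets is their
-- symmetric difference; in particular E(𝒞) is the sum of the cycle edge sets and a path is the sum
-- of its edges. The key step: if a path P ends at the vertex where a path Q starts and both avoid
-- the cycles, then E(P) ⊕ E(Q) ⊕ E(𝒞) is covered by two paths, since each cycle c₁ … cₘ can be
-- absorbed by extending P through it and prepending cₘ c₁ to Q (the edge from P's end to c₁ then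
-- occurs in both paths and cancels). So it suffices to write {ab} plus the at most two cycles
-- through a and b as E(P) ⊕ E(Q) for two such paths: P = b, Q = b a if neither lies on a cycle;
-- P = a α₁ … ω, Q = ω a b (or just ω if b = ω) for a cycle a α₁ … ω through a alone; and
-- P = a b β₁ α₁ … ω, Q = ω a α₁ β₁ … b if b lies on a second cycle b β₁ …, the crossing edge α₁β₁
-- cancelling.
module Submission where

open import Defs
open import Data.Nat using (ℕ; _≤_; s≤s; z≤n)
open import Data.Bool using (true; false; T; _∧_; _∨_; _xor_)
open import Data.Bool.Properties using (T-∨; T-∧; ∧-comm; ∨-comm; xor-assoc; xor-identityʳ)
open import Data.Bool.Solver using (module xor-∧-Solver)
open import Data.Fin using (Fin; _≟_)
open import Data.List using (List; []; _∷_; _++_; concat)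
open import Data.List.Properties using (++-identityʳ)
open import Data.List.Relation.Unary.All as All using (All; []; _∷_)
import Data.List.Relation.Unary.All.Properties as Allₚ
open import Data.List.Relation.Unary.AllPairs using ([]; _∷_)
open import Data.List.Relation.Unary.Any using (here; there; any?)
open import Data.List.Relation.Unary.Unique.Propositional using (Unique)
import Data.List.Relation.Unary.Unique.Propositional.Properties as Uniqueₚ
open import Data.List.Relation.Binary.Permutation.Propositional
  using (_↭_; refl; prep; swap; trans; ↭-trans; ↭-sym; ↭⇒↭ₛ)
open import Data.List.Relation.Binary.Permutation.Propositional.Properties
  using (All-resp-↭; ∈-resp-↭; ↭-length; shift; shifts; ++-comm; ++⁺ˡ; ++⁺ʳ)
import Data.List.Relation.Binary.Permutation.Setoid.Properties as Permutationₛ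
open import Data.List.Membership.Propositional using (_∈_; _∉_)
open import Data.List.Membership.Propositional.Properties using (∈-++⁺ˡ; ∈-++⁺ʳ; ∈-∃++; ∈-concat⁻′)
open import Data.Product using (Σ; ∃₂; _×_; _,_; proj₁; proj₂)
import Data.Product as Product
open import Data.Sum using (_⊎_; inj₁; inj₂)
import Data.Sum as Sum
open import Data.Empty using (⊥; ⊥-elim)
open import Function using (_∘_; Equivalence)
open import Relation.Binary.PropositionalEquality
  using (_≡_; _≢_; refl; sym; cong; cong₂; subst; setoid; module ≡-Reasoning)
import Relation.Binary.PropositionalEquality as ≡
open import Relation.Nullary using (¬_; yes; no)
open import Relation.Nullary.Decidable using (⌊_⌋; toWitness)

open Equivalence using (to)
open xor-∧-Solver using (solve; _:+_; _:=_; con)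

private variable
  n : ℕ
  a b x : Fin n
  xs ys : List (Fin n)
  𝒞 𝒟 : List (List (Fin n))

infix 4 _≐_
_≐_ : EdgeSet n → EdgeSet n → Set
A ≐ B = ∀ u v → A u v ≡ B u v

≐-sym : {A B : EdgeSet n} → A ≐ B → B ≐ A
≐-sym A≐B u v = sym (A≐B u v)

≐-trans : {A B C : EdgeSet n} → A ≐ B → B ≐ C → A ≐ C
≐-trans A≐B B≐C u v = ≡.trans (A≐B u v) (B≐C u v)

⊕ₑ-congˡ : (A : EdgeSet n) {B C : EdgeSet n} → B ≐ C → A ⊕ₑ B ≐ A ⊕ₑ C
⊕ₑ-congˡ A B≐C u v = cong (A u v xor_) (B≐C u v)

EdgeDisjoint : EdgeSet n → EdgeSet n → Set
EdgeDisjoint {n} A B = ∀ (u v : Fin n) → T (A u v) → T (B u v) → ⊥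

∨≡xor : ∀ {p q} → (T p → T q → ⊥) → p ∨ q ≡ p xor q
∨≡xor {true}  {true}  disjoint = ⊥-elim (disjoint _ _)
∨≡xor {true}  {false} _        = refl
∨≡xor {false}         _        = refl

∪ₑ≐⊕ₑ : {A B : EdgeSet n} → EdgeDisjoint A B → A ∪ₑ B ≐ A ⊕ₑ B
∪ₑ≐⊕ₑ disjoint u v = ∨≡xor (disjoint u v)

edgeInd-sym : (a b : Fin n) → edgeInd a b ≐ edgeInd b a
edgeInd-sym a b u v = ≡.trans (cong₂ _∨_ (∧-comm ⌊ a ≟ u ⌋ ⌊ b ≟ v ⌋) (∧-comm ⌊ a ≟ v ⌋ ⌊ b ≟ u ⌋))
                               (∨-comm (⌊ b ≟ v ⌋ ∧ ⌊ a ≟ u ⌋) (⌊ b ≟ u ⌋ ∧ ⌊ a ≟ v ⌋))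

edgeInd⇒ends : ∀ (a b u v : Fin n) → T (edgeInd a b u v) → (a ≡ u × b ≡ v) ⊎ (a ≡ v × b ≡ u)
edgeInd⇒ends a b u v = Sum.map both both ∘ T-∨ {⌊ a ≟ u ⌋ ∧ ⌊ b ≟ v ⌋} .to
  where
  both : ∀ {x y w z : Fin n} → T (⌊ x ≟ w ⌋ ∧ ⌊ y ≟ z ⌋) → x ≡ w × y ≡ z
  both {x = x} {w = w} = Product.map toWitness toWitness ∘ T-∧ {⌊ x ≟ w ⌋} .to

edgeInd-same : ∀ (a b c d u v : Fin n) → T (edgeInd a b u v) → T (edgeInd c d u v) →
               (a ≡ c × b ≡ d) ⊎ (a ≡ d × b ≡ c)
edgeInd-same a b c d u v ab cd with edgeInd⇒ends a b u v ab | edgeInd⇒ends c d u v cd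
... | inj₁ (refl , refl) | inj₁ (refl , refl) = inj₁ (refl , refl)
... | inj₁ (refl , refl) | inj₂ (refl , refl) = inj₂ (refl , refl)
... | inj₂ (refl , refl) | inj₁ (refl , refl) = inj₂ (refl , refl)
... | inj₂ (refl , refl) | inj₂ (refl , refl) = inj₁ (refl , refl)

EdgesWithin : List (Fin n) → EdgeSet n → Set
EdgesWithin xs E = ∀ u v → T (E u v) → u ∈ xs × v ∈ xs

edgeInd-end∈ : ∀ (a b u v : Fin n) → T (edgeInd a b u v) → u ∈ xs × v ∈ xs → a ∈ xs
edgeInd-end∈ a b u v ab (u∈ , v∈) with edgeInd⇒ends a b u v ab
... | inj₁ (refl , _) = u∈
... | inj₂ (refl , _) = v∈

last'∈ : (x : Fin n) (xs : List (Fin n)) → last' x xs ∈ x ∷ xs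
last'∈ x []       = here refl
last'∈ x (y ∷ ys) = there (last'∈ y ys)

last'-++ : ∀ (x : Fin n) xs y ys → last' x (xs ++ y ∷ ys) ≡ last' y ys
last'-++ x []       y ys = refl
last'-++ x (z ∷ zs) y ys = last'-++ z zs y ys

walkEdges-within : (xs : List (Fin n)) → EdgesWithin xs (walkEdges xs)
walkEdges-within []          _ _ ()
walkEdges-within (x ∷ [])    _ _ ()
walkEdges-within (x ∷ y ∷ r) u v uv =
  Sum.[ firstEdge , Product.map there there ∘ walkEdges-within (y ∷ r) u v ]′ (T-∨ {edgeInd x y u v} .to uv)
  where
  firstEdge : T (edgeInd x y u v) → u ∈ x ∷ y ∷ r × v ∈ x ∷ y ∷ r
  firstEdge xy with edgeInd⇒ends x y u v xy
  ... | inj₁ (refl , refl) = here refl , there (here refl)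
  ... | inj₂ (refl , refl) = there (here refl) , here refl

cycleEdges-within : (c : List (Fin n)) → EdgesWithin c (cycleEdges c)
cycleEdges-within (a ∷ vs) u v uv with T-∨ {walkEdges (a ∷ vs) u v} .to uv
... | inj₁ walk = walkEdges-within (a ∷ vs) u v walk
... | inj₂ closing with edgeInd⇒ends (last' a vs) a u v closing
...   | inj₁ (refl , refl) = last'∈ a vs , here refl
...   | inj₂ (refl , refl) = here refl , last'∈ a vs

cyclesEdges-within : (𝒞 : List (List (Fin n))) → EdgesWithin (concat 𝒞) (cyclesEdges 𝒞)
cyclesEdges-within []      _ _ ()
cyclesEdges-within (c ∷ 𝒞) u v uv with T-∨ {cycleEdges c u v} .to uv
... | inj₁ first = Product.map ∈-++⁺ˡ ∈-++⁺ˡ (cycleEdges-within c u v first)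
... | inj₂ rest  = Product.map (∈-++⁺ʳ c) (∈-++⁺ʳ c) (cyclesEdges-within 𝒞 u v rest)

Unique-∷ : x ∉ xs → Unique xs → Unique (x ∷ xs)
Unique-∷ {xs = xs} x∉ uniq = Allₚ.¬Any⇒All¬ xs x∉ ∷ uniq

Unique-++⁻ : ∀ xs → Unique (xs ++ ys) → Unique xs × Unique ys × All (_∉ ys) xs
Unique-++⁻ []       uniq = [] , uniq , []
Unique-++⁻ (x ∷ xs) (x≢ ∷ uniq) =
  let uniqˡ , uniqʳ , apart = Unique-++⁻ xs uniq in
  Unique-∷ (Allₚ.All¬⇒¬Any (Allₚ.++⁻ˡ xs x≢)) uniqˡ , uniqʳ , Allₚ.All¬⇒¬Any (Allₚ.++⁻ʳ xs x≢) ∷ apart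

Unique-resp-↭ : xs ↭ ys → Unique xs → Unique ys
Unique-resp-↭ p = Permutationₛ.Unique-resp-↭ (setoid _) (↭⇒↭ₛ p)

concat-↭ : 𝒞 ↭ 𝒟 → concat 𝒞 ↭ concat 𝒟
concat-↭ refl         = refl
concat-↭ (prep c p)   = ++⁺ˡ c (concat-↭ p)
concat-↭ (swap c d p) = ↭-trans (shifts c d) (++⁺ˡ d (++⁺ˡ c (concat-↭ p)))
concat-↭ (trans p q)  = ↭-trans (concat-↭ p) (concat-↭ q)

IsCycle-resp-↭ : xs ↭ ys → IsCycle xs → IsCycle ys
IsCycle-resp-↭ p (long , uniq) = subst (3 ≤_) (↭-length p) long , Unique-resp-↭ p uniq

VertexDisjointCycles-∷⁻ : ∀ {c} → VertexDisjointCycles (c ∷ 𝒞) →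
  IsCycle c × VertexDisjointCycles 𝒞 × All (_∉ concat 𝒞) c
VertexDisjointCycles-∷⁻ {c = c} (isCycle ∷ cycles , uniq) =
  let _ , uniq′ , apart = Unique-++⁻ c uniq in isCycle , (cycles , uniq′) , apart

VertexDisjointCycles-resp-↭ : 𝒞 ↭ 𝒟 → VertexDisjointCycles 𝒞 → VertexDisjointCycles 𝒟
VertexDisjointCycles-resp-↭ p (cycles , uniq) = All-resp-↭ p cycles , Unique-resp-↭ (concat-↭ p) uniq

VertexDisjointCycles-∷-resp-↭ˡ : ∀ {c c′} → c ↭ c′ →
  VertexDisjointCycles (c ∷ 𝒞) → VertexDisjointCycles (c′ ∷ 𝒞)
VertexDisjointCycles-∷-resp-↭ˡ {𝒞 = 𝒞} p (isCycle ∷ cycles , uniq) =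
  IsCycle-resp-↭ p isCycle ∷ cycles , Unique-resp-↭ (++⁺ʳ (concat 𝒞) p) uniq

VertexDisjointCycles-∷-resp-↭ʳ : ∀ {c 𝒟′} → concat 𝒟 ↭ concat 𝒟′ → VertexDisjointCycles 𝒟′ →
  VertexDisjointCycles (c ∷ 𝒟) → VertexDisjointCycles (c ∷ 𝒟′)
VertexDisjointCycles-∷-resp-↭ʳ {c = c} p (cycles′ , _) (isCycle ∷ _ , uniq) =
  isCycle ∷ cycles′ , Unique-resp-↭ (++⁺ˡ c p) uniq

walkSum : List (Fin n) → EdgeSet n
walkSum []           = ∅ₑ
walkSum (a ∷ [])     = ∅ₑ
walkSum (a ∷ b ∷ vs) = edgeInd a b ⊕ₑ walkSum (b ∷ vs)

cycleSum : List (Fin n) → EdgeSet n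
cycleSum []       = ∅ₑ
cycleSum (a ∷ vs) = walkSum (a ∷ vs) ⊕ₑ edgeInd (last' a vs) a

cyclesSum : List (List (Fin n)) → EdgeSet n
cyclesSum []       = ∅ₑ
cyclesSum (c ∷ cs) = cycleSum c ⊕ₑ cyclesSum cs

walkEdges≐walkSum : Unique xs → walkEdges xs ≐ walkSum xs
walkEdges≐walkSum {xs = []}          _ u v = refl
walkEdges≐walkSum {xs = x ∷ []}      _ u v = refl
walkEdges≐walkSum {xs = x ∷ y ∷ r} uniq@(_ ∷ uniq′) u v =
  ≡.trans (∪ₑ≐⊕ₑ firstEdgeNew u v) (cong (edgeInd x y u v xor_) (walkEdges≐walkSum uniq′ u v))
  where
  firstEdgeNew : EdgeDisjoint (edgeInd x y) (walkEdges (y ∷ r))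
  firstEdgeNew u v xy rest =
    Uniqueₚ.Unique[x∷xs]⇒x∉xs uniq (edgeInd-end∈ x y u v xy (walkEdges-within (y ∷ r) u v rest))

cycleEdges≐cycleSum : {c : List (Fin n)} → IsCycle c → cycleEdges c ≐ cycleSum c
cycleEdges≐cycleSum {c = _ ∷ []}     (s≤s () , _)
cycleEdges≐cycleSum {c = _ ∷ _ ∷ []} (s≤s (s≤s ()) , _)
cycleEdges≐cycleSum {c = a ∷ b ∷ d ∷ r} (_ , uniq@(_ ∷ uniq′)) u v =
  ≡.trans (∪ₑ≐⊕ₑ closingEdgeNew u v) (cong (_xor edgeInd ℓ a u v) (walkEdges≐walkSum uniq u v))
  where
  ℓ = last' d r
  a∉ : a ∉ b ∷ d ∷ r
  a∉ = Uniqueₚ.Unique[x∷xs]⇒x∉xs uniq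
  b∉ : b ∉ d ∷ r
  b∉ = Uniqueₚ.Unique[x∷xs]⇒x∉xs uniq′
  closingEdgeNew : EdgeDisjoint (walkEdges (a ∷ b ∷ d ∷ r)) (edgeInd ℓ a)
  closingEdgeNew u v walk closing with T-∨ {edgeInd a b u v} .to walk
  ... | inj₂ rest =
    a∉ (edgeInd-end∈ a ℓ u v (subst T (edgeInd-sym ℓ a u v) closing) (walkEdges-within (b ∷ d ∷ r) u v rest))
  ... | inj₁ ab with edgeInd-same a b ℓ a u v ab closing
  ...   | inj₁ (_ , b≡a) = a∉ (here (sym b≡a))
  ...   | inj₂ (_ , b≡ℓ) = b∉ (subst (_∈ d ∷ r) (sym b≡ℓ) (last'∈ d r))

cyclesEdges≐cyclesSum : VertexDisjointCycles 𝒞 → cyclesEdges 𝒞 ≐ cyclesSum 𝒞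
cyclesEdges≐cyclesSum {𝒞 = []}    _   u v = refl
cyclesEdges≐cyclesSum {𝒞 = c ∷ 𝒞} vdc u v with isCycle , vdc′ , apart ← VertexDisjointCycles-∷⁻ vdc =
  ≡.trans (∪ₑ≐⊕ₑ edgesApart u v)
          (cong₂ _xor_ (cycleEdges≐cycleSum isCycle u v) (cyclesEdges≐cyclesSum vdc′ u v))
  where
  edgesApart : EdgeDisjoint (cycleEdges c) (cyclesEdges 𝒞)
  edgesApart u v first rest =
    All.lookup apart (proj₁ (cycleEdges-within c u v first)) (proj₁ (cyclesEdges-within 𝒞 u v rest))

walkSum-++ : ∀ (x : Fin n) xs y ys →
  walkSum (x ∷ xs ++ y ∷ ys) ≐ walkSum (x ∷ xs) ⊕ₑ (edgeInd (last' x xs) y ⊕ₑ walkSum (y ∷ ys))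
walkSum-++ x []       y ys u v = refl
walkSum-++ x (z ∷ zs) y ys u v =
  ≡.trans (cong (edgeInd x z u v xor_) (walkSum-++ z zs y ys u v))
          (sym (xor-assoc (edgeInd x z u v) (walkSum (z ∷ zs) u v) _))

cycleSum-rotate : ∀ xs (a : Fin n) ys → cycleSum (xs ++ a ∷ ys) ≐ cycleSum (a ∷ ys ++ xs)
cycleSum-rotate []       a ys u v rewrite ++-identityʳ ys = refl
cycleSum-rotate (x ∷ xs) a ys u v
  rewrite walkSum-++ x xs a ys u v | walkSum-++ a ys x xs u v | last'-++ x xs a ys | last'-++ a ys x xs =
  solve 4 (λ p q r s → (p :+ (q :+ r)) :+ s := (r :+ (s :+ p)) :+ q) refl
    (walkSum (x ∷ xs) u v) (edgeInd (last' x xs) a u v) (walkSum (a ∷ ys) u v) (edgeInd (last' a ys) x u v)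

cyclesSum-resp-↭ : 𝒞 ↭ 𝒟 → cyclesSum 𝒞 ≐ cyclesSum 𝒟
cyclesSum-resp-↭ refl         u v = refl
cyclesSum-resp-↭ (prep c p)   u v = cong (cycleSum c u v xor_) (cyclesSum-resp-↭ p u v)
cyclesSum-resp-↭ (swap c d p) u v =
  ≡.trans (cong (λ s → cycleSum c u v xor (cycleSum d u v xor s)) (cyclesSum-resp-↭ p u v))
          (solve 3 (λ p q r → p :+ (q :+ r) := q :+ (p :+ r)) refl (cycleSum c u v) (cycleSum d u v) _)
cyclesSum-resp-↭ (trans p q)  u v = ≡.trans (cyclesSum-resp-↭ p u v) (cyclesSum-resp-↭ q u v)

cycleThrough : VertexDisjointCycles 𝒞 → a ∈ concat 𝒞 →
  ∃₂ λ α 𝒟 → VertexDisjointCycles ((a ∷ α) ∷ 𝒟) × concat 𝒞 ↭ concat ((a ∷ α) ∷ 𝒟)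
           × cyclesSum 𝒞 ≐ cyclesSum ((a ∷ α) ∷ 𝒟)
cycleThrough {𝒞 = 𝒞} {a = a} vdc a∈
  with A , a∈A , A∈𝒞 ← ∈-concat⁻′ 𝒞 a∈
  with 𝒞₁ , 𝒞₂ , refl ← ∈-∃++ A∈𝒞
  with xs , ys , refl ← ∈-∃++ a∈A =
  ys ++ xs , 𝒞₁ ++ 𝒞₂ ,
  VertexDisjointCycles-∷-resp-↭ˡ rotate (VertexDisjointCycles-resp-↭ toFront vdc) ,
  ↭-trans (concat-↭ toFront) (++⁺ʳ (concat (𝒞₁ ++ 𝒞₂)) rotate) ,
  ≐-trans (cyclesSum-resp-↭ toFront)
          (λ u v → cong (_xor cyclesSum (𝒞₁ ++ 𝒞₂) u v) (cycleSum-rotate xs a ys u v))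
  where
  toFront = shift (xs ++ a ∷ ys) 𝒞₁ 𝒞₂
  rotate  = ++-comm xs (a ∷ ys)

record TwoPathCover (E : EdgeSet n) : Set where
  constructor cover
  field
    P₁ P₂   : List (Fin n)
    isPath₁ : IsPath P₁
    isPath₂ : IsPath P₂
    covers  : walkSum P₁ ⊕ₑ walkSum P₂ ≐ E

TwoPathCover-resp : {E F : EdgeSet n} → E ≐ F → TwoPathCover E → TwoPathCover F
TwoPathCover-resp E≐F (cover P₁ P₂ isPath₁ isPath₂ covers) =
  cover P₁ P₂ isPath₁ isPath₂ (≐-trans covers E≐F)

absorbCycles : VertexDisjointCycles 𝒟 → ∀ p ps z q → last' p ps ≡ z →
  Unique (p ∷ ps) → Unique (z ∷ q) → All (_∉ concat 𝒟) (p ∷ ps) → All (_∉ concat 𝒟) (z ∷ q) →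
  TwoPathCover ((walkSum (p ∷ ps) ⊕ₑ walkSum (z ∷ q)) ⊕ₑ cyclesSum 𝒟)
absorbCycles {𝒟 = []} _ p ps z q _ uniqP uniqQ _ _ =
  cover (p ∷ ps) (z ∷ q) (s≤s z≤n , uniqP) (s≤s z≤n , uniqQ) (λ u v → sym (xor-identityʳ _))
absorbCycles {𝒟 = [] ∷ _}       ((() , _) ∷ _ , _)
absorbCycles {𝒟 = (_ ∷ []) ∷ _} ((s≤s () , _) ∷ _ , _)
absorbCycles {𝒟 = (c₁ ∷ c₂ ∷ cs) ∷ 𝒟} vdc p ps .(last' p ps) q refl uniqP uniqQ P∉ Q∉
  with (_ , uniqC) , vdc′ , C∉ ← VertexDisjointCycles-∷⁻ vdc =
  TwoPathCover-resp sums
    (absorbCycles vdc′ p (ps ++ C) cₘ (c₁ ∷ z ∷ q) (last'-++ p ps c₁ (c₂ ∷ cs)) uniqP′ uniqQ′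
      (Allₚ.++⁺ (All.map (_∘ ∈-++⁺ʳ C) P∉) C∉)
      (All.lookup C∉ (there cₘ∈) ∷ All.lookup C∉ (here refl) ∷ All.map (_∘ ∈-++⁺ʳ C) Q∉))
  where
  C  = c₁ ∷ c₂ ∷ cs
  z  = last' p ps
  cₘ = last' c₂ cs
  cₘ∈ : cₘ ∈ c₂ ∷ cs
  cₘ∈ = last'∈ c₂ cs
  uniqP′ : Unique (p ∷ ps ++ C)
  uniqP′ = Uniqueₚ.++⁺ uniqP uniqC (λ (x∈P , x∈C) → All.lookup P∉ x∈P (∈-++⁺ˡ x∈C))
  uniqQ′ : Unique (cₘ ∷ c₁ ∷ z ∷ q)
  uniqQ′ = Unique-∷ cₘ∉ (Unique-∷ c₁∉ uniqQ)
    where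
    cₘ∉ : cₘ ∉ c₁ ∷ z ∷ q
    cₘ∉ (here cₘ≡c₁) = Uniqueₚ.Unique[x∷xs]⇒x∉xs uniqC (subst (_∈ c₂ ∷ cs) cₘ≡c₁ cₘ∈)
    cₘ∉ (there cₘ∈Q) = All.lookup Q∉ cₘ∈Q (∈-++⁺ˡ (there cₘ∈))
    c₁∉ : c₁ ∉ z ∷ q
    c₁∉ c₁∈Q = All.lookup Q∉ c₁∈Q (∈-++⁺ˡ {xs = C} (here refl))
  sums : (walkSum (p ∷ ps ++ C) ⊕ₑ walkSum (cₘ ∷ c₁ ∷ z ∷ q)) ⊕ₑ cyclesSum 𝒟
       ≐ (walkSum (p ∷ ps) ⊕ₑ walkSum (z ∷ q)) ⊕ₑ cyclesSum (C ∷ 𝒟)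
  sums u v rewrite walkSum-++ p ps c₁ (c₂ ∷ cs) u v | edgeInd-sym c₁ z u v =
    solve 6 (λ P E W M Q X → ((P :+ (E :+ W)) :+ (M :+ (E :+ Q))) :+ X := (P :+ Q) :+ ((W :+ M) :+ X)) refl
      (walkSum (p ∷ ps) u v) (edgeInd z c₁ u v) (walkSum C u v) (edgeInd cₘ c₁ u v) (walkSum (z ∷ q) u v)
      (cyclesSum 𝒟 u v)

coverOneCycle : ∀ {α} → VertexDisjointCycles ((a ∷ α) ∷ 𝒟) → a ≢ b → b ∉ concat 𝒟 →
  TwoPathCover (edgeInd a b ⊕ₑ cyclesSum ((a ∷ α) ∷ 𝒟))
coverOneCycle {α = []} ((s≤s () , _) ∷ _ , _)
coverOneCycle {a = a} {𝒟 = 𝒟} {b = b} {α = α₁ ∷ α′} vdc a≢b b∉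
  with (_ , uniqA@(a≢α ∷ _)) , vdc′ , A∉ ← VertexDisjointCycles-∷⁻ vdc | b ≟ last' α₁ α′
... | yes refl = TwoPathCover-resp sums
  (absorbCycles vdc′ a α ω [] refl uniqA ([] ∷ []) A∉ (All.lookup A∉ (there (last'∈ α₁ α′)) ∷ []))
  where
  α = α₁ ∷ α′
  ω = last' α₁ α′
  sums : (walkSum (a ∷ α) ⊕ₑ walkSum (ω ∷ [])) ⊕ₑ cyclesSum 𝒟 ≐ edgeInd a ω ⊕ₑ cyclesSum ((a ∷ α) ∷ 𝒟)
  sums u v rewrite edgeInd-sym a ω u v =
    solve 3 (λ W E X → (W :+ con false) :+ X := E :+ ((W :+ E) :+ X)) refl
      (walkSum (a ∷ α) u v) (edgeInd ω a u v) (cyclesSum 𝒟 u v)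
... | no b≢ω = TwoPathCover-resp sums
  (absorbCycles vdc′ a α ω (a ∷ b ∷ []) refl uniqA uniqQ A∉
    (All.lookup A∉ (there (last'∈ α₁ α′)) ∷ All.lookup A∉ (here refl) ∷ b∉ ∷ []))
  where
  α = α₁ ∷ α′
  ω = last' α₁ α′
  uniqQ : Unique (ω ∷ a ∷ b ∷ [])
  uniqQ = ((All.lookup a≢α (last'∈ α₁ α′) ∘ sym) ∷ (b≢ω ∘ sym) ∷ []) ∷ (a≢b ∷ []) ∷ [] ∷ []
  sums : (walkSum (a ∷ α) ⊕ₑ walkSum (ω ∷ a ∷ b ∷ [])) ⊕ₑ cyclesSum 𝒟
       ≐ edgeInd a b ⊕ₑ cyclesSum ((a ∷ α) ∷ 𝒟)
  sums u v =
    solve 4 (λ W E F X → (W :+ (E :+ (F :+ con false))) :+ X := F :+ ((W :+ E) :+ X)) refl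
      (walkSum (a ∷ α) u v) (edgeInd ω a u v) (edgeInd a b u v) (cyclesSum 𝒟 u v)

crossingWalks-sum : ∀ (a b α₁ : Fin n) α′ β₁ β′ →
  walkSum (a ∷ b ∷ β₁ ∷ α₁ ∷ α′) ⊕ₑ walkSum (last' α₁ α′ ∷ a ∷ α₁ ∷ β₁ ∷ β′ ++ b ∷ [])
  ≐ edgeInd a b ⊕ₑ (cycleSum (a ∷ α₁ ∷ α′) ⊕ₑ cycleSum (b ∷ β₁ ∷ β′))
crossingWalks-sum a b α₁ α′ β₁ β′ u v rewrite walkSum-++ β₁ β′ b [] u v | edgeInd-sym α₁ β₁ u v =
  solve 8 (λ Eab Ebβ Eβα Wα Eωa Eaα Wβ Eβb →
      (Eab :+ (Ebβ :+ (Eβα :+ Wα))) :+ (Eωa :+ (Eaα :+ (Eβα :+ (Wβ :+ (Eβb :+ con false)))))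
    := Eab :+ (((Eaα :+ Wα) :+ Eωa) :+ ((Ebβ :+ Wβ) :+ Eβb))) refl
    (edgeInd a b u v) (edgeInd b β₁ u v) (edgeInd β₁ α₁ u v) (walkSum (α₁ ∷ α′) u v)
    (edgeInd (last' α₁ α′) a u v) (edgeInd a α₁ u v) (walkSum (β₁ ∷ β′) u v) (edgeInd (last' β₁ β′) b u v)

coverTwoCycles : ∀ {α β ℰ} → VertexDisjointCycles ((a ∷ α) ∷ (b ∷ β) ∷ ℰ) →
  TwoPathCover (edgeInd a b ⊕ₑ cyclesSum ((a ∷ α) ∷ (b ∷ β) ∷ ℰ))
coverTwoCycles {α = []}     ((s≤s () , _) ∷ _ , _)
coverTwoCycles {α = _ ∷ []} ((s≤s (s≤s ()) , _) ∷ _ , _)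
coverTwoCycles {β = []}     (_ ∷ (s≤s () , _) ∷ _ , _)
coverTwoCycles {a = a} {b = b} {α = α₁ ∷ α₂ ∷ α″} {β = β₁ ∷ β′} {ℰ = ℰ} vdc
  with (_ , uniqA@(a≢α ∷ α₁≢ ∷ uniqα′)) , vdcBℰ , A∉ ← VertexDisjointCycles-∷⁻ vdc
  with (_ , uniqB@((b≢β₁ ∷ _) ∷ _)) , vdcℰ , B∉ ← VertexDisjointCycles-∷⁻ vdcBℰ =
  TwoPathCover-resp sums (absorbCycles vdcℰ a (b ∷ β₁ ∷ α) ω (a ∷ α₁ ∷ R) refl uniqP uniqQ P∉ Q∉)
  where
  α = α₁ ∷ α₂ ∷ α″
  B = b ∷ β₁ ∷ β′
  ω = last' α₂ α″
  ω∈ : ω ∈ α₂ ∷ α″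
  ω∈ = last'∈ α₂ α″
  R = β₁ ∷ β′ ++ b ∷ []
  rotateB : B ↭ R
  rotateB = ++-comm (b ∷ []) (β₁ ∷ β′)
  R⊆B : ∀ {y} → y ∈ R → y ∈ B
  R⊆B = ∈-resp-↭ (↭-sym rotateB)
  apart : ∀ {x y} → x ∈ a ∷ α → y ∈ B → x ≢ y
  apart x∈A y∈B refl = All.lookup A∉ x∈A (∈-++⁺ˡ y∈B)
  A∉ℰ : All (_∉ concat ℰ) (a ∷ α)
  A∉ℰ = All.map (_∘ ∈-++⁺ʳ B) A∉
  uniqP : Unique (a ∷ b ∷ β₁ ∷ α)
  uniqP = (apart (here refl) (here refl) ∷ apart (here refl) (there (here refl)) ∷ a≢α)
        ∷ (b≢β₁ ∷ All.tabulate (λ x∈α → apart (there x∈α) (here refl) ∘ sym))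
        ∷ All.tabulate (λ x∈α → apart (there x∈α) (there (here refl)) ∘ sym)
        ∷ α₁≢ ∷ uniqα′
  uniqQ : Unique (ω ∷ a ∷ α₁ ∷ R)
  uniqQ = ((All.lookup a≢α (there ω∈) ∘ sym) ∷ (All.lookup α₁≢ ω∈ ∘ sym)
          ∷ All.tabulate (apart (there (there ω∈)) ∘ R⊆B))
        ∷ (All.lookup a≢α (here refl) ∷ All.tabulate (apart (here refl) ∘ R⊆B))
        ∷ All.tabulate (apart (there (here refl)) ∘ R⊆B)
        ∷ Unique-resp-↭ rotateB uniqB
  P∉ : All (_∉ concat ℰ) (a ∷ b ∷ β₁ ∷ α)
  P∉ = All.lookup A∉ℰ (here refl) ∷ All.lookup B∉ (here refl) ∷ All.lookup B∉ (there (here refl))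
     ∷ All.tail A∉ℰ
  Q∉ : All (_∉ concat ℰ) (ω ∷ a ∷ α₁ ∷ R)
  Q∉ = All.lookup A∉ℰ (there (there ω∈)) ∷ All.lookup A∉ℰ (here refl) ∷ All.lookup A∉ℰ (there (here refl))
     ∷ All-resp-↭ rotateB B∉
  sums : (walkSum (a ∷ b ∷ β₁ ∷ α) ⊕ₑ walkSum (ω ∷ a ∷ α₁ ∷ R)) ⊕ₑ cyclesSum ℰ
       ≐ edgeInd a b ⊕ₑ cyclesSum ((a ∷ α) ∷ B ∷ ℰ)
  sums u v = ≡.trans (cong (_xor cyclesSum ℰ u v) (crossingWalks-sum a b α₁ (α₂ ∷ α″) β₁ β′ u v))
    (solve 4 (λ E A B X → (E :+ (A :+ B)) :+ X := E :+ (A :+ (B :+ X))) refl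
      (edgeInd a b u v) (cycleSum (a ∷ α) u v) (cycleSum B u v) (cyclesSum ℰ u v))

coverEdgeOnCycle : VertexDisjointCycles 𝒞 → a ≢ b → a ∈ concat 𝒞 → TwoPathCover (edgeInd a b ⊕ₑ cyclesSum 𝒞)
coverEdgeOnCycle {a = a} {b = b} vdc a≢b a∈
  with α , 𝒟 , vdc′ , _ , sums ← cycleThrough vdc a∈
  with _ , vdc𝒟 , _ ← VertexDisjointCycles-∷⁻ vdc′
  with any? (b ≟_) (concat 𝒟)
... | no b∉ = TwoPathCover-resp (⊕ₑ-congˡ (edgeInd a b) (≐-sym sums)) (coverOneCycle vdc′ a≢b b∉)
... | yes b∈ with β , ℰ , vdcBℰ , perm , sums′ ← cycleThrough vdc𝒟 b∈ =
  TwoPathCover-resp (⊕ₑ-congˡ (edgeInd a b) (≐-sym (≐-trans sums (⊕ₑ-congˡ (cycleSum (a ∷ α)) sums′))))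
    (coverTwoCycles (VertexDisjointCycles-∷-resp-↭ʳ perm vdcBℰ vdc′))

coverEdgeCycles : VertexDisjointCycles 𝒞 → a ≢ b → TwoPathCover (edgeInd a b ⊕ₑ cyclesSum 𝒞)
coverEdgeCycles {𝒞 = 𝒞} {a = a} {b = b} vdc a≢b with any? (a ≟_) (concat 𝒞) | any? (b ≟_) (concat 𝒞)
... | yes a∈ | _      = coverEdgeOnCycle vdc a≢b a∈
... | no _   | yes b∈ = TwoPathCover-resp (λ u v → cong (_xor cyclesSum 𝒞 u v) (edgeInd-sym b a u v))
                                          (coverEdgeOnCycle vdc (a≢b ∘ sym) b∈)
... | no a∉  | no b∉  = TwoPathCover-resp sums
  (absorbCycles vdc b [] b (a ∷ []) refl ([] ∷ []) (((a≢b ∘ sym) ∷ []) ∷ [] ∷ []) (b∉ ∷ []) (b∉ ∷ a∉ ∷ []))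
  where
  sums : (walkSum (b ∷ []) ⊕ₑ walkSum (b ∷ a ∷ [])) ⊕ₑ cyclesSum 𝒞 ≐ edgeInd a b ⊕ₑ cyclesSum 𝒞
  sums u v rewrite edgeInd-sym b a u v =
    solve 2 (λ E X → (con false :+ (E :+ con false)) :+ X := E :+ X) refl
      (edgeInd a b u v) (cyclesSum 𝒞 u v)

corollary3p6 : (n : ℕ) (𝒞 : List (List (Fin n))) → VertexDisjointCycles 𝒞 →
    (a b : Fin n) → ¬ (a ≡ b) →
    Σ (List (Fin n)) λ P₁ → Σ (List (Fin n)) λ P₂ →
      IsPath P₁ × IsPath P₂ ×
      (∀ u v → (walkEdges P₁ ⊕ₑ walkEdges P₂) u v ≡ (edgeInd a b ⊕ₑ cyclesEdges 𝒞) u v)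
corollary3p6 n 𝒞 vdc a b a≢b with cover P₁ P₂ isPath₁ isPath₂ covers ← coverEdgeCycles vdc a≢b =
  P₁ , P₂ , isPath₁ , isPath₂ , λ u v → begin
    walkEdges P₁ u v xor walkEdges P₂ u v
      ≡⟨ cong₂ _xor_ (walkEdges≐walkSum (proj₂ isPath₁) u v) (walkEdges≐walkSum (proj₂ isPath₂) u v) ⟩
    walkSum P₁ u v xor walkSum P₂ u v
      ≡⟨ covers u v ⟩
    edgeInd a b u v xor cyclesSum 𝒞 u v
      ≡⟨ cong (edgeInd a b u v xor_) (cyclesEdges≐cyclesSum vdc u v) ⟨
    edgeInd a b u v xor cyclesEdges 𝒞 u v ∎
  where open ≡-Reasoning
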